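{- Let $\mathbb{A}=(A,(\mathrm{Con}_i)_{i\in A},(\vDash_i)_{i\in A})$ be a continuous information frame. Define $\widetilde A=\bigcup_{a\in A}\{a\}\times\mathrm{Con}_a$; for $(a,X)\in\widetilde A$ let $\widetilde{\mathrm{Con}}_{(a,X)}=\{\{(a,X)\}\}\cup\{\mathfrak Y\subseteq\widetilde A\text{ finite}:(\forall (b,Y)\in\mathfrak Y)\ X\vDash_a\{b\}\cup Y\}$, and for $\mathfrak X\in\widetilde{\mathrm{Con}}_{(a,X)}$ and $(e,V)\in\widetilde A$ let $\mathfrak X\mathrel{\widetilde\vDash}_{(a,X)}(e,V)$ iff there is $(c,Z)\in\mathfrak X\cup\{(a,X)\}$ with $Z\vDash_c\{e\}\cup V$. Then $\mathcal T(\mathbb A)=(\widetilde A,(\widetilde{\mathrm{Con}}_x)_{x\in\widetilde A},(\mathrel{\widetilde\vDash}_x)_{x\in\widetilde A})$ is a strong continuous information frame.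
   Context: A continuous information frame is a triple $\mathbb{A}=(A,(\mathrm{Con}_i)_{i\in A},(\vDash_i)_{i\in A})$ where $A$ is a set, each $\mathrm{Con}_i$ is a set of finite subsets of $A$, and $\vDash_i\subseteq\mathrm{Con}_i\times A$; write $iRj$ iff $\{i\}\in\mathrm{Con}_j$, and for finite $Y$, $X\vDash_i Y$ iff $X\vDash_i b$ for all $b\in Y$. Required, for all $i,j,a\in A$ and finite $X,Y\subseteq A$: (i) $\{i\}\in\mathrm{Con}_i$; (ii) if $Y\subseteq X\in\mathrm{Con}_i$ then $Y\in\mathrm{Con}_i$; (iii) if $X\in\mathrm{Con}_i$ and $X\vDash_i Y$ then $Y\in\mathrm{Con}_i$; (iv) if $X,Y\in\mathrm{Con}_i$, $X\subseteq Y$ and $X\vDash_i a$ then $Y\vDash_i a$; (v) if $X\in\mathrm{Con}_i$, $X\vDash_i Y$ and $Y\vDash_i a$ then $X\vDash_i a$; (vi) if $iRj$ then $\mathrm{Con}_i\subseteq\mathrm{Con}_j$; (vii) if $iRj$, $X\in\mathrm{Con}_i$ and $X\vDash_i a$ then $X\vDash_j a$; (viii) if $X\vDash_i Y$ then there exist $e\in A$ and $Z\in\mathrm{Con}_e$ with $X\vDash_i \{e\}\cup Z$ and $Z\vDash_e Y$. (The same definition applies to frames whose token set is $\widetilde A$.) The frame is strong if for every token $i$ and every $X\in\mathrm{Con}_i$ with $X\neq\{i\}$ we have $\{i\}\vDash_i X$. -}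

module Defs where

open import Level using (0ℓ)
open import Data.Product using (Σ; _×_; _,_; proj₁; proj₂; ∃-syntax)
open import Data.Sum using (_⊎_)
open import Data.List using (List; []; _∷_)
open import Data.List.Relation.Unary.All using (All)
open import Data.List.Relation.Unary.Any using (Any)
open import Relation.Nullary using (¬_)
open import Relation.Binary.Bundles using (Setoid)
open import Relation.Binary.Structures using (IsEquivalence)
import Data.List.Membership.Setoid as MemS
import Data.List.Relation.Binary.Subset.Setoid as SubS

-- A "set" of tokens is modelled as a setoid; finite subsets are lists,
-- with membership, inclusion and equality (as sets) taken up to the setoid equality.

module _ (S : Setoid 0ℓ 0ℓ) where
  open Setoid S renaming (Carrier to A)
  open MemS S using (_∈_)
  open SubS S using (_⊆_)

  _≐_ : List A → List A → Set
  X ≐ Y = (X ⊆ Y) × (Y ⊆ X)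

  -- X ⊨_i Y for a finite set Y (requires X ∈ Con_i, since ⊨_i ⊆ Con_i × A)
  EntAll : (Con : A → List A → Set) (Ent : A → List A → A → Set) →
           A → List A → List A → Set
  EntAll Con Ent i X Y = Con i X × All (Ent i X) Y

  record IsCIF (Con : A → List A → Set) (Ent : A → List A → A → Set) : Set where
    field
      -- Con_i and ⊨_i are predicates on (finite) sets: they respect equality
      Con-resp : ∀ {i j X Y} → i ≈ j → X ≐ Y → Con i X → Con j Y
      Ent-resp : ∀ {i j X Y a b} → i ≈ j → X ≐ Y → a ≈ b → Ent i X a → Ent j Y b
      Ent-Con  : ∀ {i X a} → Ent i X a → Con i X
      ax1 : ∀ i → Con i (i ∷ [])
      ax2 : ∀ {i X Y} → Y ⊆ X → Con i X → Con i Y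
      ax3 : ∀ {i X Y} → Con i X → EntAll Con Ent i X Y → Con i Y
      ax4 : ∀ {i X Y a} → Con i X → Con i Y → X ⊆ Y → Ent i X a → Ent i Y a
      ax5 : ∀ {i X Y a} → Con i X → EntAll Con Ent i X Y → Ent i Y a → Ent i X a
      -- (vi)  iRj means {i} ∈ Con_j
      ax6 : ∀ {i j X} → Con j (i ∷ []) → Con i X → Con j X
      ax7 : ∀ {i j X a} → Con j (i ∷ []) → Con i X → Ent i X a → Ent j X a
      ax8 : ∀ {i X Y} → EntAll Con Ent i X Y →
            ∃[ e ] ∃[ Z ] (Con e Z × EntAll Con Ent i X (e ∷ Z) × EntAll Con Ent e Z Y)

  IsStrong : (Con : A → List A → Set) (Ent : A → List A → A → Set) → Set
  IsStrong Con Ent = ∀ i X → Con i X → ¬ (X ≐ (i ∷ [])) → EntAll Con Ent i (i ∷ []) X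

module _ (S : Setoid 0ℓ 0ℓ) (Con : Setoid.Carrier S → List (Setoid.Carrier S) → Set) where
  open Setoid S renaming (Carrier to A)

  TTok : Set
  TTok = Σ A (λ a → Σ (List A) (Con a))

  _≈T_ : TTok → TTok → Set
  (a , X , _) ≈T (b , Y , _) = (a ≈ b) × _≐_ S X Y

  ≈T-isEquivalence : IsEquivalence _≈T_
  ≈T-isEquivalence = record
    { refl  = λ {x} → refl , (λ z → z) , (λ z → z)
    ; sym   = λ (p , q , r) → sym p , r , q
    ; trans = λ (p , q , r) (p' , q' , r') → trans p p' , (λ z → q' (q z)) , (λ z → r (r' z))
    }

  TSetoid : Setoid 0ℓ 0ℓ
  TSetoid = record { Carrier = TTok ; _≈_ = _≈T_ ; isEquivalence = ≈T-isEquivalence }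

module _ (S : Setoid 0ℓ 0ℓ)
         (Con : Setoid.Carrier S → List (Setoid.Carrier S) → Set)
         (Ent : Setoid.Carrier S → List (Setoid.Carrier S) → Setoid.Carrier S → Set) where

  TCon : TTok S Con → List (TTok S Con) → Set
  TCon (a , X , p) 𝔜 =
    _≐_ (TSetoid S Con) 𝔜 ((a , X , p) ∷ [])
    ⊎ All (λ { (b , Y , _) → EntAll S Con Ent a X (b ∷ Y) }) 𝔜

  TEnt : TTok S Con → List (TTok S Con) → TTok S Con → Set
  TEnt x 𝔛 (e , V , _) =
    TCon x 𝔛 × Any (λ { (c , Z , _) → EntAll S Con Ent c Z (e ∷ V) }) (x ∷ 𝔛)

{-# OPTIONS --safe #-}
-- For tokens i = (a , X) and j = (b , Y) of T(A) write i ⊳ j when X ⊨ₐ {b} ∪ Y. By (iii), (vii)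
-- and (v) this relation is transitive, and every member of a set in Con~ᵢ reaches (via ⊳) only
-- tokens that i itself reaches. Hence 𝔛 ⊨~ᵢ k forces i ⊳ k, and the axioms of T(A) all reduce
-- to transitivity of ⊳. For (viii), applying (viii) of A to X and the union of the sets {b} ∪ Y
-- over the entailed tokens yields a single interpolating token. The frame is strong because a
-- set in Con~ᵢ other than {i} consists of tokens j with i ⊳ j.
module Submission where

open import Defs
open import Level using (0ℓ)
open import Data.Product using (_×_; _,_; proj₁; proj₂; ∃-syntax)
open import Data.Sum using (_⊎_; inj₁; inj₂)
open import Data.List using (List; []; _∷_; concatMap)
open import Data.List.Relation.Unary.All using (All; []; _∷_; lookupₛ)
import Data.List.Relation.Unary.All as All
open import Data.List.Relation.Unary.All.Properties using (concat⁺; concat⁻; map⁺; map⁻)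
open import Data.List.Relation.Unary.Any using (Any; here; there)
import Data.List.Relation.Unary.Any as Any
open import Data.Empty using (⊥-elim)
open import Relation.Binary.Bundles using (Setoid)
open import Relation.Binary.Definitions using (_Respects_)
import Data.List.Membership.Setoid as Membership
import Data.List.Relation.Binary.Subset.Setoid as Subset
import Data.List.Relation.Binary.Subset.Setoid.Properties as Subsetₚ

module FiniteSets (S : Setoid 0ℓ 0ℓ) where
  open Setoid S
  open Membership S using (_∈_)
  open Subset S using (_⊆_)

  ≐-refl : ∀ {xs} → _≐_ S xs xs
  ≐-refl = (λ m → m) , (λ m → m)

  ≐-sym : ∀ {xs ys} → _≐_ S xs ys → _≐_ S ys xs
  ≐-sym (p , q) = q , p

  ≐-trans : ∀ {xs ys zs} → _≐_ S xs ys → _≐_ S ys zs → _≐_ S xs zs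
  ≐-trans (p , q) (p′ , q′) = (λ m → p′ (p m)) , (λ m → q (q′ m))

  ∈-singleton : ∀ {x y} → y ∈ (x ∷ []) → y ≈ x
  ∈-singleton (here y≈x) = y≈x

  ∷-mono-⊆ : ∀ {x y xs ys} → x ≈ y → xs ⊆ ys → (x ∷ xs) ⊆ (y ∷ ys)
  ∷-mono-⊆ x≈y xs⊆ys (here z≈x) = here (trans z≈x x≈y)
  ∷-mono-⊆ x≈y xs⊆ys (there z∈xs) = there (xs⊆ys z∈xs)

  singleton-≐ : ∀ {x y} → x ≈ y → _≐_ S (x ∷ []) (y ∷ [])
  singleton-≐ x≈y = ∷-mono-⊆ x≈y (λ ()) , ∷-mono-⊆ (sym x≈y) (λ ())

  ⊆-singleton⇒≐ : ∀ {x y ys} → (y ∷ ys) ⊆ (x ∷ []) → _≐_ S (y ∷ ys) (x ∷ [])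
  ⊆-singleton⇒≐ sub = sub , λ z∈x → here (trans (∈-singleton z∈x) (sym (∈-singleton (sub (here refl)))))

module TokenFrame (S : Setoid 0ℓ 0ℓ)
                  (Con : Setoid.Carrier S → List (Setoid.Carrier S) → Set)
                  (Ent : Setoid.Carrier S → List (Setoid.Carrier S) → Setoid.Carrier S → Set)
                  (cif : IsCIF S Con Ent) where
  open Setoid S renaming (Carrier to A)
  open IsCIF cif
  open Subset S using (_⊆_)
  open FiniteSets S

  T : Set
  T = TTok S Con

  TS : Setoid 0ℓ 0ℓ
  TS = TSetoid S Con

  open Setoid TS using () renaming (_≈_ to _≈ᵀ_; refl to reflᵀ)
  open Membership TS using () renaming (_∈_ to _∈ᵀ_; find to findᵀ)
  open Subset TS using () renaming (_⊆_ to _⊆ᵀ_)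
  module Tok = FiniteSets TS

  Conᵀ : T → List T → Set
  Conᵀ = TCon S Con Ent

  Entᵀ : T → List T → T → Set
  Entᵀ = TEnt S Con Ent

  EntAllᵀ : T → List T → List T → Set
  EntAllᵀ = EntAll TS Conᵀ Entᵀ

  _⊨_ : A → List A → List A → Set
  _⊨_ = EntAll S Con Ent

  ⊨-resp : ∀ {a a′ X X′ W W′} → a ≈ a′ → _≐_ S X X′ → W′ ⊆ W → (a ⊨ X) W → (a′ ⊨ X′) W′
  ⊨-resp a≈a′ X≐X′ W′⊆W (conX , ents) =
    Con-resp a≈a′ X≐X′ conX ,
    Subsetₚ.All-resp-⊇ S (Ent-resp refl ≐-refl) W′⊆W (All.map (Ent-resp a≈a′ X≐X′ refl) ents)

  support : T → List A
  support (b , Y , _) = b ∷ Y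

  infix 4 _⊳_ _≼_

  _⊳_ : T → T → Set
  (a , X , _) ⊳ j = (a ⊨ X) (support j)

  -- X ⊨ₐ b gives bRa, so Y ⊨_b W lifts to Y ⊨ₐ W by (vii), and then (v) applies.
  ⊳-trans : ∀ {i j k} → i ⊳ j → j ⊳ k → i ⊳ k
  ⊳-trans (conX , X⊨b ∷ X⊨Y) (conY , Y⊨W) =
    conX , All.map (λ Y⊨w → ax5 conX (conX , X⊨Y) (ax7 (ax3 conX (conX , X⊨b ∷ [])) conY Y⊨w)) Y⊨W

  support-resp : ∀ {j j′} → j ≈ᵀ j′ → support j′ ⊆ support j
  support-resp {_ , _ , _} {_ , _ , _} (b≈b′ , _ , Y′⊆Y) = ∷-mono-⊆ (sym b≈b′) Y′⊆Y

  ⊳-respˡ : ∀ k → (_⊳ k) Respects _≈ᵀ_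
  ⊳-respˡ _ {_ , _ , _} {_ , _ , _} (a≈a′ , X≐X′) = ⊨-resp a≈a′ X≐X′ (Subsetₚ.⊆-refl S)

  ⊳-respʳ : ∀ i → (i ⊳_) Respects _≈ᵀ_
  ⊳-respʳ (_ , _ , _) {j} {j′} j≈j′ = ⊨-resp refl ≐-refl (support-resp {j} {j′} j≈j′)

  All⊳-resp-⊇ : ∀ {i 𝔛 𝔜} → 𝔜 ⊆ᵀ 𝔛 → All (i ⊳_) 𝔛 → All (i ⊳_) 𝔜
  All⊳-resp-⊇ {i} {𝔛} {𝔜} 𝔜⊆𝔛 =
    Subsetₚ.All-resp-⊇ TS {P = i ⊳_} (λ {x} {y} → ⊳-respʳ i {x} {y}) {𝔛} {𝔜} (λ {x} → 𝔜⊆𝔛 {x})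

  Any⊳-resp-⊆ : ∀ {k 𝔛 𝔜} → 𝔛 ⊆ᵀ 𝔜 → Any (_⊳ k) 𝔛 → Any (_⊳ k) 𝔜
  Any⊳-resp-⊆ {k} {𝔛} {𝔜} 𝔛⊆𝔜 =
    Subsetₚ.Any-resp-⊆ TS {P = _⊳ k} (λ {x} {y} → ⊳-respˡ k {x} {y}) {𝔛} {𝔜} (λ {x} → 𝔛⊆𝔜 {x})

  _≼_ : T → T → Set
  j ≼ i = ∀ {k} → j ⊳ k → i ⊳ k

  Conᵀ⇒≼ : ∀ {i 𝔛 j} → Conᵀ i 𝔛 → j ∈ᵀ 𝔛 → j ≼ i
  Conᵀ⇒≼ {i} {𝔛} {j} (inj₁ (𝔛⊆i , _)) j∈𝔛 {k} =
    ⊳-respˡ k {j} {i} (Tok.∈-singleton {i} {j} (𝔛⊆i {j} j∈𝔛))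
  Conᵀ⇒≼ {i} {𝔛} {j} (inj₂ i⊳𝔛) j∈𝔛 {k} =
    ⊳-trans {i} {j} {k} (lookupₛ TS {P = i ⊳_} (λ {x} {y} → ⊳-respʳ i {x} {y}) i⊳𝔛 {j} j∈𝔛)

  Entᵀ⇒⊳ : ∀ {i 𝔛 k} → Entᵀ i 𝔛 k → i ⊳ k
  Entᵀ⇒⊳ (_ , here i⊳k) = i⊳k
  Entᵀ⇒⊳ {i} {𝔛} {k} (con , there 𝔛⊳k) =
    let j , j∈𝔛 , j⊳k = findᵀ {P = _⊳ k} 𝔛⊳k in Conᵀ⇒≼ {i} {𝔛} {j} con j∈𝔛 {k} j⊳k

  Conᵀ-resp : ∀ {i j 𝔛 𝔜} → i ≈ᵀ j → _≐_ TS 𝔛 𝔜 → Conᵀ i 𝔛 → Conᵀ j 𝔜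
  Conᵀ-resp {i} {j} i≈j 𝔛≐𝔜 (inj₁ 𝔛≐i) =
    inj₁ (Tok.≐-trans (Tok.≐-sym 𝔛≐𝔜) (Tok.≐-trans 𝔛≐i (Tok.singleton-≐ {i} {j} i≈j)))
  Conᵀ-resp {i} {j} {𝔛} i≈j (_ , 𝔜⊆𝔛) (inj₂ i⊳𝔛) =
    inj₂ (All⊳-resp-⊇ {j} {𝔛} (λ {x} → 𝔜⊆𝔛 {x}) (All.map (λ {k} → ⊳-respˡ k {i} {j} i≈j) i⊳𝔛))

  Entᵀ-resp : ∀ {i j 𝔛 𝔜 k l} → i ≈ᵀ j → _≐_ TS 𝔛 𝔜 → k ≈ᵀ l → Entᵀ i 𝔛 k → Entᵀ j 𝔜 l
  Entᵀ-resp {i} {j} {𝔛} {𝔜} {k} {l} i≈j 𝔛≐𝔜 k≈l (con , 𝔛⊳k) =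
    Conᵀ-resp {i} {j} i≈j 𝔛≐𝔜 con ,
    Any⊳-resp-⊆ {l} {i ∷ 𝔛} {j ∷ 𝔜}
      (λ {x} → Tok.∷-mono-⊆ {i} {j} {𝔛} {𝔜} i≈j (λ {z} → proj₁ 𝔛≐𝔜 {z}) {x})
      (Any.map {P = _⊳ k} (λ {x} → ⊳-respʳ x {k} {l} k≈l) 𝔛⊳k)

  Conᵀ-downClosed : ∀ {i 𝔛 𝔜} → 𝔜 ⊆ᵀ 𝔛 → Conᵀ i 𝔛 → Conᵀ i 𝔜
  Conᵀ-downClosed {𝔜 = []} _ (inj₁ _) = inj₂ []
  Conᵀ-downClosed {i} {𝔛} {j ∷ 𝔜} 𝔜⊆𝔛 (inj₁ (𝔛⊆i , _)) =
    inj₁ (Tok.⊆-singleton⇒≐ {i} {j} {𝔜} (λ {x} x∈𝔜 → 𝔛⊆i {x} (𝔜⊆𝔛 {x} x∈𝔜)))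
  Conᵀ-downClosed {i} {𝔛} {𝔜} 𝔜⊆𝔛 (inj₂ i⊳𝔛) =
    inj₂ (All⊳-resp-⊇ {i} {𝔛} {𝔜} (λ {x} → 𝔜⊆𝔛 {x}) i⊳𝔛)

  Conᵀ-singleton : ∀ {i j} → Conᵀ j (i ∷ []) → i ≈ᵀ j ⊎ j ⊳ i
  Conᵀ-singleton {i} {j} (inj₁ (i⊆j , _)) = inj₁ (Tok.∈-singleton {j} {i} (i⊆j {i} (here (reflᵀ {i}))))
  Conᵀ-singleton (inj₂ (j⊳i ∷ [])) = inj₂ j⊳i

  Conᵀ-singleton⇒≼ : ∀ {i j} → Conᵀ j (i ∷ []) → i ≼ j
  Conᵀ-singleton⇒≼ {i} {j} r {k} = Conᵀ⇒≼ {j} {i ∷ []} {i} r (here (reflᵀ {i})) {k}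

  Conᵀ-lift : ∀ {i j 𝔛} → Conᵀ j (i ∷ []) → Conᵀ i 𝔛 → Conᵀ j 𝔛
  Conᵀ-lift {i} {j} r (inj₂ i⊳𝔛) = inj₂ (All.map (λ {k} → Conᵀ-singleton⇒≼ {i} {j} r {k}) i⊳𝔛)
  Conᵀ-lift {i} {j} {𝔛} r (inj₁ 𝔛≐i) with Conᵀ-singleton {i} {j} r
  ... | inj₁ i≈j = inj₁ (Tok.≐-trans 𝔛≐i (Tok.singleton-≐ {i} {j} i≈j))
  ... | inj₂ j⊳i =
    inj₂ (All⊳-resp-⊇ {j} {i ∷ []} {𝔛} (λ {x} → proj₁ 𝔛≐i {x}) (j⊳i ∷ []))

  Entᵀ-lift : ∀ {i j 𝔛 k} → Conᵀ j (i ∷ []) → Conᵀ i 𝔛 → Entᵀ i 𝔛 k → Entᵀ j 𝔛 k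
  Entᵀ-lift {i} {j} {𝔛} {k} r con (_ , here i⊳k) =
    Conᵀ-lift {i} {j} {𝔛} r con , here (Conᵀ-singleton⇒≼ {i} {j} r {k} i⊳k)
  Entᵀ-lift {i} {j} {𝔛} r con (_ , there 𝔛⊳k) = Conᵀ-lift {i} {j} {𝔛} r con , there 𝔛⊳k

  Entᵀ-mono : ∀ {i 𝔛 𝔜 k} → Conᵀ i 𝔜 → 𝔛 ⊆ᵀ 𝔜 → Entᵀ i 𝔛 k → Entᵀ i 𝔜 k
  Entᵀ-mono {i} {𝔛} {𝔜} {k} con 𝔛⊆𝔜 (_ , 𝔛⊳k) =
    con , Any⊳-resp-⊆ {k} {i ∷ 𝔛} {i ∷ 𝔜} (λ {x} → Subsetₚ.∷⁺ʳ TS i (λ {z} → 𝔛⊆𝔜 {z}) {x}) 𝔛⊳k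

  Entᵀ-trans : ∀ {i 𝔛 𝔜 k} → Conᵀ i 𝔛 → EntAllᵀ i 𝔛 𝔜 → Entᵀ i 𝔜 k → Entᵀ i 𝔛 k
  Entᵀ-trans con _ (_ , here i⊳k) = con , here i⊳k
  Entᵀ-trans {i} {𝔛} {𝔜} {k} con (_ , 𝔛⊨𝔜) (_ , there 𝔜⊳k) =
    let j , j∈𝔜 , j⊳k = findᵀ {P = _⊳ k} 𝔜⊳k
        _ , 𝔛⊳j = lookupₛ TS {P = Entᵀ i 𝔛}
                    (λ {x} {y} → Entᵀ-resp {i} {i} {𝔛} {𝔛} {x} {y} (reflᵀ {i}) Tok.≐-refl) 𝔛⊨𝔜 {j} j∈𝔜
    in con , Any.map (λ {d} d⊳j → ⊳-trans {d} {j} {k} d⊳j j⊳k) 𝔛⊳j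

  supports : List T → List A
  supports = concatMap support

  All⊳⇒⊨supports : ∀ {a X conX 𝔜} → All ((a , X , conX) ⊳_) 𝔜 → (a ⊨ X) (supports 𝔜)
  All⊳⇒⊨supports {conX = conX} i⊳𝔜 = conX , concat⁺ (map⁺ (All.map proj₂ i⊳𝔜))

  ⊨supports⇒All⊳ : ∀ {e W conW 𝔜} → (e ⊨ W) (supports 𝔜) → All ((e , W , conW) ⊳_) 𝔜
  ⊨supports⇒All⊳ {conW = conW} (_ , W⊨supports𝔜) = All.map (conW ,_) (map⁻ (concat⁻ W⊨supports𝔜))

  EntAllᵀ⇒All⊳ : ∀ {i 𝔛 𝔜} → EntAllᵀ i 𝔛 𝔜 → All (i ⊳_) 𝔜
  EntAllᵀ⇒All⊳ {i} {𝔛} (_ , 𝔛⊨𝔜) = All.map (λ {k} → Entᵀ⇒⊳ {i} {𝔛} {k}) 𝔛⊨𝔜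

  -- The interpolant is the single token (e , W) given by (viii) for X ⊨ₐ supports 𝔜.
  Entᵀ-interpolate : ∀ {i 𝔛 𝔜} → EntAllᵀ i 𝔛 𝔜 →
                     ∃[ t ] ∃[ 𝔚 ] (Conᵀ t 𝔚 × EntAllᵀ i 𝔛 (t ∷ 𝔚) × EntAllᵀ t 𝔚 𝔜)
  Entᵀ-interpolate {a , X , conX} {𝔛} {𝔜} 𝔛⊨𝔜@(con , _)
    with ax8 (All⊳⇒⊨supports {a} {X} {conX} {𝔜} (EntAllᵀ⇒All⊳ {a , X , conX} {𝔛} 𝔛⊨𝔜))
  ... | e , W , conW , (_ , X⊨eW) , W⊨supports𝔜 =
    (e , W , conW) , [] , inj₂ [] , (con , (con , here (conX , X⊨eW)) ∷ []) ,
    (inj₂ [] , All.map (λ t⊳j → inj₂ [] , here t⊳j) (⊨supports⇒All⊳ {e} {W} {conW} {𝔜} W⊨supports𝔜))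

  isCIF : IsCIF TS Conᵀ Entᵀ
  isCIF = record
    { Con-resp = Conᵀ-resp
    ; Ent-resp = λ {i} {j} {𝔛} {𝔜} {k} {l} → Entᵀ-resp {i} {j} {𝔛} {𝔜} {k} {l}
    ; Ent-Con  = proj₁
    ; ax1      = λ _ → inj₁ Tok.≐-refl
    ; ax2      = Conᵀ-downClosed
    ; ax3      = λ {i} {𝔛} _ 𝔛⊨𝔜 → inj₂ (EntAllᵀ⇒All⊳ {i} {𝔛} 𝔛⊨𝔜)
    ; ax4      = λ {i} {𝔛} {𝔜} {k} _ con 𝔛⊆𝔜 → Entᵀ-mono {i} {𝔛} {𝔜} {k} con (λ {x} → 𝔛⊆𝔜 {x})
    ; ax5      = λ {i} {𝔛} {𝔜} {k} → Entᵀ-trans {i} {𝔛} {𝔜} {k}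
    ; ax6      = Conᵀ-lift
    ; ax7      = λ {i} {j} {𝔛} {k} → Entᵀ-lift {i} {j} {𝔛} {k}
    ; ax8      = Entᵀ-interpolate
    }

  isStrong : IsStrong TS Conᵀ Entᵀ
  isStrong _ _ (inj₁ 𝔛≐i) 𝔛≢i = ⊥-elim (𝔛≢i 𝔛≐i)
  isStrong _ _ (inj₂ i⊳𝔛) _ = singleton , All.map (λ i⊳x → singleton , here i⊳x) i⊳𝔛
    where singleton = inj₁ Tok.≐-refl

theorem5p1 : (S : Setoid 0ℓ 0ℓ)
             (Con : Setoid.Carrier S → List (Setoid.Carrier S) → Set)
             (Ent : Setoid.Carrier S → List (Setoid.Carrier S) → Setoid.Carrier S → Set) →
             IsCIF S Con Ent →
             IsCIF (TSetoid S Con) (TCon S Con Ent) (TEnt S Con Ent)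
               × IsStrong (TSetoid S Con) (TCon S Con Ent) (TEnt S Con Ent)
theorem5p1 S Con Ent cif = TokenFrame.isCIF S Con Ent cif , TokenFrame.isStrong S Con Ent cif
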